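{- Let $\mathcal V$ be an almost structurally complete variety with free algebra $\mathbf F$ of countably infinite rank, and suppose there is a $\mathcal V$-finitely presented unifiable algebra $\mathbf P$ that does not embed into $\mathbf F$. Then $\mathcal V$ does not have unitary unification.
   Context: For a quasi-identity $q=(\forall\bar x)[\varphi\to\psi]$ ($\varphi$ a finite conjunction of equations, $\psi$ an equation) let $q^*=(\forall\bar x)\neg\varphi$; $q$ true in $\mathbf F$ is active if $q^*$ fails in $\mathbf F$; $\mathcal V$ is almost structurally complete if every active quasi-identity holds in $\mathcal V$. An algebra is $\mathcal V$-finitely presented if it is isomorphic to $\mathbf F(k)/\theta$ with $\mathbf F(k)$ the free algebra of finite rank $k$ and $\theta$ the congruence generated by finitely many pairs. A unifier for $\mathbf P$ is a homomorphism $\mathbf P\to\mathbf F$; $\mathbf P$ is unifiable if it has one. $\mathcal V$ has unitary unification if every $\mathcal V$-finitely presented unifiable algebra $\mathbf P$ has a most general unifier $u$, i.e. a unifier such that every unifier $v$ of $\mathbf P$ equals $h\circ u$ for some endomorphism $h$ of $\mathbf F$. -}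

module Defs where

open import Data.Nat using (ℕ)
open import Data.Fin using (Fin)
open import Data.Empty using (⊥)
open import Data.Product using (Σ; _×_; _,_; proj₁; proj₂)
open import Data.List using (List)
open import Data.List.Membership.Propositional using (_∈_)
open import Data.List.Relation.Unary.All using (All)
open import Relation.Nullary using (¬_)
open import Relation.Binary using (IsEquivalence)

record Signature : Set₁ where
  field
    Op : Set
    ar : Op → ℕ

module _ (S : Signature) where
  open Signature S

  data Term (X : Set) : Set where
    var : X → Term X
    op  : (o : Op) → (Fin (ar o) → Term X) → Term X

  record Algebra : Set₁ where
    field
      Carrier : Set
      _≈_     : Carrier → Carrier → Set
      isEquiv : IsEquivalence _≈_
      ⟦_⟧     : (o : Op) → (Fin (ar o) → Carrier) → Carrier
      ⟦⟧-cong : (o : Op) (xs ys : Fin (ar o) → Carrier) →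
                (∀ i → xs i ≈ ys i) → ⟦ o ⟧ xs ≈ ⟦ o ⟧ ys

  eval : (A : Algebra) {X : Set} → (X → Algebra.Carrier A) → Term X → Algebra.Carrier A
  eval A ρ (var x)   = ρ x
  eval A ρ (op o ts) = Algebra.⟦_⟧ A o (λ i → eval A ρ (ts i))

  subst : {X Y : Set} → (X → Term Y) → Term X → Term Y
  subst σ (var x)   = σ x
  subst σ (op o ts) = op o (λ i → subst σ (ts i))

  record Hom (A B : Algebra) : Set where
    private
      module A = Algebra A
      module B = Algebra B
    field
      fun   : A.Carrier → B.Carrier
      cong  : ∀ {x y} → x A.≈ y → fun x B.≈ fun y
      homo  : (o : Op) (xs : Fin (ar o) → A.Carrier) →
              fun (A.⟦ o ⟧ xs) B.≈ B.⟦ o ⟧ (λ i → fun (xs i))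

-- Varieties, given (Birkhoff) by a set of defining identities in
-- countably many variables.

record Variety : Set₁ where
  field
    sig : Signature
    Ax  : Term sig ℕ → Term sig ℕ → Set

module _ (V : Variety) where
  open Variety V
  open Signature sig

  _∈V : Algebra sig → Set
  A ∈V = ∀ s t → Ax s t → ∀ (ρ : ℕ → Algebra.Carrier A) →
         Algebra._≈_ A (eval sig A ρ s) (eval sig A ρ t)

  data Deriv {X : Set} (R : Term sig X → Term sig X → Set) :
             Term sig X → Term sig X → Set where
    ax    : ∀ {s t} → Ax s t → (σ : ℕ → Term sig X) →
            Deriv R (subst sig σ s) (subst sig σ t)
    gen   : ∀ {s t} → R s t → Deriv R s t
    refl  : ∀ {s} → Deriv R s s
    sym   : ∀ {s t} → Deriv R s t → Deriv R t s
    trans : ∀ {s t u} → Deriv R s t → Deriv R t u → Deriv R s u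
    cong  : (o : Op) {ts us : Fin (ar o) → Term sig X} →
            (∀ i → Deriv R (ts i) (us i)) → Deriv R (op o ts) (op o us)

  -- T(X) / (congruence generated by V-identities and R)
  TermAlg : (X : Set) → (Term sig X → Term sig X → Set) → Algebra sig
  TermAlg X R = record
    { Carrier = Term sig X
    ; _≈_     = Deriv R
    ; isEquiv = record { refl = refl ; sym = sym ; trans = trans }
    ; ⟦_⟧     = op
    ; ⟦⟧-cong = λ o xs ys p → cong o p
    }

  F : Algebra sig
  F = TermAlg ℕ (λ _ _ → ⊥)

  -- finite presentations: F(k)/θ with θ generated by finitely many pairs
  record Presentation : Set where
    field
      rank : ℕ
      rels : List (Term sig (Fin rank) × Term sig (Fin rank))

  PAlg : Presentation → Algebra sig
  PAlg P = TermAlg (Fin (Presentation.rank P)) (λ s t → (s , t) ∈ Presentation.rels P)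

  Unifier : Presentation → Set
  Unifier P = Hom sig (PAlg P) F

  Unifiable : Presentation → Set
  Unifiable P = Unifier P

  EmbedsIntoF : Presentation → Set
  EmbedsIntoF P = Σ (Hom sig (PAlg P) F) λ e →
    ∀ x y → Algebra._≈_ F (Hom.fun e x) (Hom.fun e y) → Algebra._≈_ (PAlg P) x y

  IsMGU : (P : Presentation) → Unifier P → Set
  IsMGU P u = ∀ (v : Unifier P) → Σ (Hom sig F F) λ h →
    ∀ x → Algebra._≈_ F (Hom.fun v x) (Hom.fun h (Hom.fun u x))

  UnitaryUnification : Set
  UnitaryUnification = ∀ (P : Presentation) → Unifiable P → Σ (Unifier P) (IsMGU P)

  record QuasiIdentity : Set where
    field
      premises   : List (Term sig ℕ × Term sig ℕ)
      conclusion : Term sig ℕ × Term sig ℕ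

  module _ (A : Algebra sig) where
    private
      _≈A_ = Algebra._≈_ A
    SatEq : (ℕ → Algebra.Carrier A) → Term sig ℕ × Term sig ℕ → Set
    SatEq ρ e = eval sig A ρ (proj₁ e) ≈A eval sig A ρ (proj₂ e)

    HoldsIn : QuasiIdentity → Set
    HoldsIn q = ∀ (ρ : ℕ → Algebra.Carrier A) →
      All (SatEq ρ) (QuasiIdentity.premises q) → SatEq ρ (QuasiIdentity.conclusion q)

    StarHoldsIn : QuasiIdentity → Set
    StarHoldsIn q = ∀ (ρ : ℕ → Algebra.Carrier A) →
      ¬ All (SatEq ρ) (QuasiIdentity.premises q)

  Active : QuasiIdentity → Set
  Active q = HoldsIn F q × ¬ StarHoldsIn F q

  HoldsInV : QuasiIdentity → Set₁
  HoldsInV q = ∀ (A : Algebra sig) → A ∈V → HoldsIn A q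

  AlmostStructurallyComplete : Set₁
  AlmostStructurallyComplete = ∀ (q : QuasiIdentity) → Active q → HoldsInV q

-- An mgu u of P is injective. If u x ≈ u y, consider the quasi-identity
-- "the defining relations of P imply x ≈ y". It holds in F: an assignment
-- satisfying the relations is a unifier v = h ∘ u, so v x ≈ h (u x) ≈ h (u y) ≈ v y.
-- It is active, because u itself provides an assignment satisfying the relations.
-- By almost structural completeness it holds in P ∈ V, and evaluating it at the
-- generators of P gives x ≈ y in P. Hence P embeds into F via u.
module Submission where

open import Defs
open import Function using (_∘_)
open import Data.Nat using (ℕ; zero; suc)
open import Data.Fin using (Fin; toℕ; zero; suc)
open import Data.Product using (Σ; _×_; _,_)
import Data.Product as Product
open import Data.List using (List; map)
open import Data.List.Membership.Propositional using (_∈_)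
open import Data.List.Relation.Unary.All using (All; lookup; tabulate)
open import Data.List.Relation.Unary.All.Properties using (map⁺; map⁻)
open import Relation.Nullary using (¬_)
open import Relation.Binary using (IsEquivalence; Setoid)
open import Relation.Binary.PropositionalEquality as ≡ using (_≡_)
import Relation.Binary.Reasoning.Setoid as SetoidReasoning

module _ {S : Signature} (A : Algebra S) where
  open Signature S
  open Algebra A
  open IsEquivalence isEquiv using () renaming (refl to ≈-refl)

  setoid : Setoid _ _
  setoid = record { isEquivalence = isEquiv }

  eval-subst : {X Y : Set} (ρ : Y → Carrier) (σ : X → Term S Y) (t : Term S X) →
               eval S A ρ (subst S σ t) ≈ eval S A (eval S A ρ ∘ σ) t
  eval-subst ρ σ (var x)   = ≈-refl
  eval-subst ρ σ (op o ts) = ⟦⟧-cong o _ _ (λ i → eval-subst ρ σ (ts i))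

  eval-cong : {X : Set} {ρ ρ′ : X → Carrier} → (∀ x → ρ x ≈ ρ′ x) →
              (t : Term S X) → eval S A ρ t ≈ eval S A ρ′ t
  eval-cong ρ≈ρ′ (var x)   = ρ≈ρ′ x
  eval-cong ρ≈ρ′ (op o ts) = ⟦⟧-cong o _ _ (λ i → eval-cong ρ≈ρ′ (ts i))

  id-hom : Hom S A A
  id-hom = record { fun = λ a → a ; cong = λ a≈b → a≈b ; homo = λ o xs → ≈-refl }

-- The default d is the value beyond the first k naturals (needed when k = 0).
extendℕ : {B : Set} {k : ℕ} → (Fin k → B) → B → ℕ → B
extendℕ {k = zero}  ρ d n       = d
extendℕ {k = suc k} ρ d zero    = ρ zero
extendℕ {k = suc k} ρ d (suc n) = extendℕ (ρ ∘ suc) d n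

extendℕ-toℕ : {B : Set} {k : ℕ} (ρ : Fin k → B) (d : B) (i : Fin k) →
              extendℕ ρ d (toℕ i) ≡ ρ i
extendℕ-toℕ ρ d zero    = ≡.refl
extendℕ-toℕ ρ d (suc i) = extendℕ-toℕ (ρ ∘ suc) d i

module _ (V : Variety) where
  open Variety V
  open Signature sig

  eval-TermAlg : {X Y : Set} (R : Term sig Y → Term sig Y → Set)
                 (σ : X → Term sig Y) (t : Term sig X) →
                 Deriv V R (eval sig (TermAlg V Y R) σ t) (subst sig σ t)
  eval-TermAlg R σ (var x)   = refl
  eval-TermAlg R σ (op o ts) = cong o (λ i → eval-TermAlg R σ (ts i))

  TermAlg∈V : (X : Set) (R : Term sig X → Term sig X → Set) → _∈V V (TermAlg V X R)
  TermAlg∈V X R s t s≈t ρ =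
    trans (eval-TermAlg R ρ s) (trans (ax s≈t ρ) (sym (eval-TermAlg R ρ t)))

  hom-eval : {X : Set} {R : Term sig X → Term sig X → Set} (B : Algebra sig)
             (h : Hom sig (TermAlg V X R) B) (t : Term sig X) →
             Algebra._≈_ B (Hom.fun h t) (eval sig B (Hom.fun h ∘ var) t)
  hom-eval B h (var x)   = IsEquivalence.refl (Algebra.isEquiv B)
  hom-eval B h (op o ts) = IsEquivalence.trans (Algebra.isEquiv B) (Hom.homo h o ts)
    (Algebra.⟦⟧-cong B o _ _ (λ i → hom-eval B h (ts i)))

  eval-var : {X : Set} {R : Term sig X → Term sig X → Set} (t : Term sig X) →
             Deriv V R t (eval sig (TermAlg V X R) var t)
  eval-var t = hom-eval _ (id-hom _) t

  module _ (P : Presentation V) where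
    open Presentation P

    private
      _≈F_ : Term sig ℕ → Term sig ℕ → Set
      _≈F_ = Algebra._≈_ (F V)
      _≈P_ : Term sig (Fin rank) → Term sig (Fin rank) → Set
      _≈P_ = Algebra._≈_ (PAlg V P)

    Solution : (A : Algebra sig) → (Fin rank → Algebra.Carrier A) → Set
    Solution A ρ = ∀ {s t} → (s , t) ∈ rels → Algebra._≈_ A (eval sig A ρ s) (eval sig A ρ t)

    solution-hom : (A : Algebra sig) → _∈V V A →
                   (ρ : Fin rank → Algebra.Carrier A) → Solution A ρ → Hom sig (PAlg V P) A
    solution-hom A A∈V ρ sol = record
      { fun  = eval sig A ρ
      ; cong = eval-respects
      ; homo = λ o xs → IsEquivalence.refl (Algebra.isEquiv A)
      }
      where
      open Algebra A
      open IsEquivalence isEquiv renaming (refl to ≈-refl; sym to ≈-sym; trans to ≈-trans)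
      eval-respects : ∀ {s t} → s ≈P t → eval sig A ρ s ≈ eval sig A ρ t
      eval-respects (ax {s} {t} s≈t σ) =
        ≈-trans (eval-subst A ρ σ s) (≈-trans (A∈V s t s≈t _) (≈-sym (eval-subst A ρ σ t)))
      eval-respects (gen st)       = sol st
      eval-respects refl           = ≈-refl
      eval-respects (sym d)        = ≈-sym (eval-respects d)
      eval-respects (trans d e)    = ≈-trans (eval-respects d) (eval-respects e)
      eval-respects (cong o ds)    = ⟦⟧-cong o _ _ (λ i → eval-respects (ds i))

    hom-solution : (A : Algebra sig) (h : Hom sig (PAlg V P) A) → Solution A (Hom.fun h ∘ var)
    hom-solution A h {s} {t} st = begin
      eval sig A (Hom.fun h ∘ var) s ≈⟨ hom-eval A h s ⟨
      Hom.fun h s                    ≈⟨ Hom.cong h (gen st) ⟩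
      Hom.fun h t                    ≈⟨ hom-eval A h t ⟩
      eval sig A (Hom.fun h ∘ var) t ∎
      where open SetoidReasoning (setoid A)

    ren : Term sig (Fin rank) → Term sig ℕ
    ren = subst sig (var ∘ toℕ)

    renamedRelations : List (Term sig ℕ × Term sig ℕ)
    renamedRelations = map (Product.map ren ren) rels

    relationsImply : (x y : Term sig (Fin rank)) → QuasiIdentity V
    relationsImply x y = record { premises = renamedRelations ; conclusion = ren x , ren y }

    eval-ren-extendℕ : (A : Algebra sig) (ρ : Fin rank → Algebra.Carrier A)
                       (d : Algebra.Carrier A) (s : Term sig (Fin rank)) →
                       Algebra._≈_ A (eval sig A (extendℕ ρ d) (ren s)) (eval sig A ρ s)
    eval-ren-extendℕ A ρ d s = IsEquivalence.trans (Algebra.isEquiv A)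
      (eval-subst A (extendℕ ρ d) (var ∘ toℕ) s)
      (eval-cong A (IsEquivalence.reflexive (Algebra.isEquiv A) ∘ extendℕ-toℕ ρ d) s)

    premises-solution : (A : Algebra sig) (ρ : ℕ → Algebra.Carrier A) →
                        All (SatEq V A ρ) renamedRelations → Solution A (ρ ∘ toℕ)
    premises-solution A ρ sat {s} {t} st = begin
      eval sig A (ρ ∘ toℕ) s ≈⟨ eval-subst A ρ (var ∘ toℕ) s ⟨
      eval sig A ρ (ren s)   ≈⟨ lookup (map⁻ sat) st ⟩
      eval sig A ρ (ren t)   ≈⟨ eval-subst A ρ (var ∘ toℕ) t ⟩
      eval sig A (ρ ∘ toℕ) t ∎
      where open SetoidReasoning (setoid A)

    solution-premises : (A : Algebra sig) (ρ : Fin rank → Algebra.Carrier A)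
                        (d : Algebra.Carrier A) →
                        Solution A ρ → All (SatEq V A (extendℕ ρ d)) renamedRelations
    solution-premises A ρ d sol = map⁺ (tabulate λ { {s , t} st → begin
      eval sig A (extendℕ ρ d) (ren s) ≈⟨ eval-ren-extendℕ A ρ d s ⟩
      eval sig A ρ s                   ≈⟨ sol st ⟩
      eval sig A ρ t                   ≈⟨ eval-ren-extendℕ A ρ d t ⟨
      eval sig A (extendℕ ρ d) (ren t) ∎ })
      where open SetoidReasoning (setoid A)

    mgu-kernel-holdsIn-F : (u : Unifier V P) → IsMGU V P u →
                           ∀ x y → Hom.fun u x ≈F Hom.fun u y → HoldsIn V (F V) (relationsImply x y)
    mgu-kernel-holdsIn-F u mgu x y ux≈uy ρ sat = begin
      eval sig (F V) ρ (ren x) ≈⟨ eval-subst (F V) ρ (var ∘ toℕ) x ⟩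
      Hom.fun v x              ≈⟨ v≈h∘u x ⟩
      Hom.fun h (Hom.fun u x)  ≈⟨ Hom.cong h ux≈uy ⟩
      Hom.fun h (Hom.fun u y)  ≈⟨ v≈h∘u y ⟨
      Hom.fun v y              ≈⟨ eval-subst (F V) ρ (var ∘ toℕ) y ⟨
      eval sig (F V) ρ (ren y) ∎
      where
      open SetoidReasoning (setoid (F V))
      v : Unifier V P
      v = solution-hom (F V) (TermAlg∈V ℕ _) (ρ ∘ toℕ) (premises-solution (F V) ρ sat)
      open Product.Σ (mgu v) renaming (proj₁ to h; proj₂ to v≈h∘u)

    unifier-refutes-star : Unifier V P → ∀ x y → ¬ StarHoldsIn V (F V) (relationsImply x y)
    unifier-refutes-star u x y star =
      star _ (solution-premises (F V) (Hom.fun u ∘ var) (var 0) (hom-solution (F V) u))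

    holdsIn-presentation : ∀ x y → HoldsIn V (PAlg V P) (relationsImply x y) → x ≈P y
    holdsIn-presentation x y holds = begin
      x                               ≈⟨ eval-var x ⟩
      eval sig (PAlg V P) var x       ≈⟨ eval-ren-extendℕ (PAlg V P) var x x ⟨
      eval sig (PAlg V P) ρ (ren x)   ≈⟨ holds ρ generators-satisfy ⟩
      eval sig (PAlg V P) ρ (ren y)   ≈⟨ eval-ren-extendℕ (PAlg V P) var x y ⟩
      eval sig (PAlg V P) var y       ≈⟨ eval-var y ⟨
      y                               ∎
      where
      open SetoidReasoning (setoid (PAlg V P))
      ρ : ℕ → Term sig (Fin rank)
      ρ = extendℕ var x
      generators-satisfy : All (SatEq V (PAlg V P) ρ) renamedRelations
      generators-satisfy = solution-premises (PAlg V P) var x (hom-solution _ (id-hom _))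

    mgu-injective : AlmostStructurallyComplete V → (u : Unifier V P) → IsMGU V P u →
                    ∀ x y → Hom.fun u x ≈F Hom.fun u y → x ≈P y
    mgu-injective asc u mgu x y ux≈uy = holdsIn-presentation x y
      (asc (relationsImply x y)
           (mgu-kernel-holdsIn-F u mgu x y ux≈uy , unifier-refutes-star u x y)
           (PAlg V P) (TermAlg∈V _ _))

lemma7p15 : (V : Variety) → AlmostStructurallyComplete V →
            Σ (Presentation V) (λ P → Unifiable V P × ¬ EmbedsIntoF V P) →
            ¬ UnitaryUnification V
lemma7p15 V asc (P , u₀ , no-embedding) unitary with unitary P u₀
... | u , mgu = no-embedding (u , mgu-injective V P asc u mgu)
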